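{- Let $\mathcal Q$ be a finite quiver with vertex set $\{0,1,\dots,n-1\}$ (with $n\ge 1$) that is reverse topologically sorted, i.e. every arrow from $u$ to $v$ satisfies $u>v$. Let $u_0=n-1$, and let $a_0$ be an arrow of $\mathcal Q$ with source $u_0$ and target $v_0$. Let $\mathcal Q'$ be the quiver obtained from $\mathcal Q$ by removing the arrow $a_0$. Let $l'\subseteq\mathcal{BP}_{\mathcal Q'}$ be a set of bipaths with $\mathrm{cl}_{\mathcal Q'}(l')=\mathcal{BP}_{\mathcal Q'}$. Let $\widetilde W=\mathrm{acc}(u_0)\cap\mathrm{acc}(v_0)$ be the set of vertices accessible in $\mathcal Q'$ both from $u_0$ and from $v_0$. Let $$W=\{w\in\widetilde W\mid \forall w'\in\widetilde W\setminus\{w\},\ w\notin\mathrm{acc}(w')\}.$$ For each $w\in W$ choose a path $p_w$ of $\mathcal Q'$ from $u_0$ to $w$ and a path $q_w$ of $\mathcal Q'$ from $v_0$ to $w$. Set $$l=l'\cup\{(p_w,\ a_0\cdot q_w)\mid w\in W\}.$$ Then $\mathrm{cl}_{\mathcal Q}(l)=\mathcal{BP}_{\mathcal Q}$.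
   Context: Quiver and paths. A quiver consists of a finite set of vertices, a finite set of arrows (parallel arrows allowed), and source and target maps. A path from $u$ to $v$ is a finite sequence of arrows $e_1,\dots,e_k$ such that: - the source of $e_1$ is $u$, - the target of $e_k$ is $v$, - the target of $e_j$ is the source of $e_{j+1}$ for each $j$. The empty path from $u$ to $u$ is allowed. We write $p\cdot q$ for concatenation and $a\cdot q$ when the first factor is a single arrow $a$. $\mathrm{acc}(x)$ denotes the set of vertices $y$ such that there is a path (possibly empty) from $x$ to $y$ in $\mathcal Q'$. Bipaths. For a quiver $\mathcal R$, $\mathcal{BP}_{\mathcal R}$ denotes the set of pairs of paths of $\mathcal R$ with the same source and the same target (bipaths). Path relations. A path relation on $\mathcal R$ assigns to each pair of vertices $(u,v)$ an equivalence relation on paths from $u$ to $v$, stable under concatenation: $p\sim p'$ and $q\sim q'$ (composable) imply $p\cdot q\sim p'\cdot q'$. For a set $l$ of bipaths, $\mathrm{cl}_{\mathcal R}(l)$ is the smallest path relation on $\mathcal R$ containing $l$, viewed as a set of bipaths. Bipaths of $\mathcal Q'$ are regarded as bipaths of $\mathcal Q$. -}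

module Defs where

open import Data.Nat using (ℕ)
open import Data.Fin using (Fin)
open import Data.Product using (Σ; _×_; _,_; proj₁)
open import Relation.Binary.PropositionalEquality using (_≡_; _≢_)
open import Relation.Nullary using (¬_)

record Quiver (V : Set) : Set₁ where
  field
    Arr : Set
    src : Arr → V
    tgt : Arr → V
open Quiver public

finQuiver : {n m : ℕ} → (Fin m → Fin n) → (Fin m → Fin n) → Quiver (Fin n)
finQuiver {n} {m} s t = record { Arr = Fin m ; src = s ; tgt = t }

module _ {V : Set} (Q : Quiver V) where

  data Path : V → V → Set where
    []  : ∀ {u} → Path u u
    _∷_ : ∀ {v} (a : Arr Q) → Path (tgt Q a) v → Path (src Q a) v

  infixr 5 _∷_

_++_ : ∀ {V} {Q : Quiver V} {u v w : V} → Path Q u v → Path Q v w → Path Q u w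
[]      ++ q = q
(a ∷ p) ++ q = a ∷ (p ++ q)

infixr 5 _++_

BipathSet : ∀ {V} → Quiver V → Set₁
BipathSet {V} Q = ∀ {u v : V} → Path Q u v → Path Q u v → Set

data Cl {V : Set} (Q : Quiver V) (l : BipathSet Q) : ∀ {u v : V} → Path Q u v → Path Q u v → Set where
  gen   : ∀ {u v} {p q : Path Q u v} → l p q → Cl Q l p q
  rfl   : ∀ {u v} {p : Path Q u v} → Cl Q l p p
  sym   : ∀ {u v} {p q : Path Q u v} → Cl Q l p q → Cl Q l q p
  trans : ∀ {u v} {p q r : Path Q u v} → Cl Q l p q → Cl Q l q r → Cl Q l p r
  cong  : ∀ {u v w} {p p' : Path Q u v} {q q' : Path Q v w} →
          Cl Q l p p' → Cl Q l q q' → Cl Q l (p ++ q) (p' ++ q')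

ClIsAll : ∀ {V} (Q : Quiver V) → BipathSet Q → Set
ClIsAll {V} Q l = ∀ {u v : V} (p q : Path Q u v) → Cl Q l p q

remove : ∀ {V} (Q : Quiver V) → Arr Q → Quiver V
remove Q a₀ = record { Arr = Σ (Arr Q) (λ a → a ≢ a₀)
                     ; src = λ a → src Q (proj₁ a)
                     ; tgt = λ a → tgt Q (proj₁ a) }

embed : ∀ {V} {Q : Quiver V} {a₀ : Arr Q} {u v : V} → Path (remove Q a₀) u v → Path Q u v
embed []      = []
embed (a ∷ p) = proj₁ a ∷ embed p

module _ {V : Set} (Q : Quiver V) (a₀ : Arr Q) where

  acc : V → V → Set
  acc x y = Path (remove Q a₀) x y

  W̃ : V → Set
  W̃ w = acc (src Q a₀) w × acc (tgt Q a₀) w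

  W : V → Set
  W w = W̃ w × (∀ w' → W̃ w' → w' ≢ w → ¬ acc w' w)

  data Lnew (l' : BipathSet (remove Q a₀))
            (pw : ∀ w → W w → Path (remove Q a₀) (src Q a₀) w)
            (qw : ∀ w → W w → Path (remove Q a₀) (tgt Q a₀) w)
            : ∀ {u v : V} → Path Q u v → Path Q u v → Set where
    old : ∀ {u v} {p q : Path (remove Q a₀) u v} → l' p q → Lnew l' pw qw (embed p) (embed q)
    new : ∀ w (h : W w) → Lnew l' pw qw (embed (pw w h)) (a₀ ∷ embed (qw w h))

-- Arrows strictly decrease vertices and a₀ starts at the top vertex, so every path of Q
-- either avoids a₀ or is a₀ followed by a path avoiding a₀; pairs of paths avoiding a₀
-- are identified by l'.  For a pair p : u₀ → v, a₀·q with q : v₀ → v, the vertex v is in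
-- W̃; replacing it by a vertex of W̃ ∖ {v} reaching it, as long as one exists, strictly
-- increases the vertex, so this ends at some w ∈ W with a path r : w → v.  Then
-- p ~ p_w·r ~ a₀·q_w·r ~ a₀·q, the outer steps by l' and the middle one by (p_w, a₀·q_w).
module Submission where

open import Defs
open import Data.Nat using (ℕ; suc; _<_; _≤_)
open import Data.Nat.Properties using (≤-refl; ≤-trans; <⇒≤; ≤-<-trans; <-≤-trans; <-trans; <-irrefl)
open import Data.Fin using (Fin; toℕ; fromℕ)
import Data.Fin as Fin
open import Data.Fin.Properties using (toℕ≤pred[n]; toℕ-fromℕ; any?) renaming (_≟_ to _≟ᶠ_)
open import Data.Fin.Induction using (<-wellFounded; >-wellFounded)
open import Data.Product using (Σ; _×_; _,_; proj₁; proj₂)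
open import Data.Empty using (⊥-elim)
open import Function using (_∘_)
open import Induction.WellFounded as WF using (Acc)
open import Relation.Binary.Bundles using (Setoid)
open import Relation.Binary.Definitions using (DecidableEquality)
open import Relation.Binary.PropositionalEquality as ≡ using (_≡_; _≢_; refl; subst₂)
import Relation.Binary.Reasoning.Setoid as SetoidReasoning
open import Relation.Nullary using (Dec; yes; no)
open import Relation.Nullary.Decidable using (_×-dec_; ¬?; map′)

Cl-setoid : ∀ {V} (Q : Quiver V) (l : BipathSet Q) (u v : V) → Setoid _ _
Cl-setoid Q l u v = record
  { Carrier       = Path Q u v
  ; _≈_           = Cl Q l
  ; isEquivalence = record { refl = rfl ; sym = sym ; trans = trans }
  }

Cl-∷ : ∀ {V} {Q : Quiver V} {l : BipathSet Q} {v} (a : Arr Q) {p q : Path Q (tgt Q a) v} →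
       Cl Q l p q → Cl Q l (a ∷ p) (a ∷ q)
Cl-∷ a = cong {p = a ∷ []} rfl

module _ {V : Set} {Q : Quiver V} {a₀ : Arr Q} where

  embed-++ : ∀ {u v w} (p : Path (remove Q a₀) u v) (q : Path (remove Q a₀) v w) →
             embed (p ++ q) ≡ embed p ++ embed q
  embed-++ []      q = refl
  embed-++ (a ∷ p) q = ≡.cong (proj₁ a ∷_) (embed-++ p q)

  embed-Cl : {l' : BipathSet (remove Q a₀)} {l : BipathSet Q} →
             (∀ {u v} {p q : Path (remove Q a₀) u v} → l' p q → l (embed p) (embed q)) →
             ∀ {u v} {p q : Path (remove Q a₀) u v} →
             Cl (remove Q a₀) l' p q → Cl Q l (embed p) (embed q)
  embed-Cl l'⊆l (gen pq)    = gen (l'⊆l pq)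
  embed-Cl l'⊆l rfl         = rfl
  embed-Cl l'⊆l (sym c)     = sym (embed-Cl l'⊆l c)
  embed-Cl l'⊆l (trans c d) = trans (embed-Cl l'⊆l c) (embed-Cl l'⊆l d)
  embed-Cl l'⊆l (cong {p = p} {p'} {q} {q'} c d) =
    subst₂ (Cl Q _) (≡.sym (embed-++ p q)) (≡.sym (embed-++ p' q'))
      (cong (embed-Cl l'⊆l c) (embed-Cl l'⊆l d))

data Shape {V : Set} (Q : Quiver V) (a₀ : Arr Q) : ∀ {u v} → Path Q u v → Set where
  avoiding : ∀ {u v} (p : Path (remove Q a₀) u v) → Shape Q a₀ (embed p)
  via-a₀   : ∀ {v} (p : Path (remove Q a₀) (tgt Q a₀) v) → Shape Q a₀ (a₀ ∷ embed p)

module _ {V : Set} {Q : Quiver V} {a₀ : Arr Q}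
         {l' : BipathSet (remove Q a₀)} (l'-all : ClIsAll (remove Q a₀) l')
         (pw : ∀ w → W Q a₀ w → Path (remove Q a₀) (src Q a₀) w)
         (qw : ∀ w → W Q a₀ w → Path (remove Q a₀) (tgt Q a₀) w) where

  private
    L : BipathSet Q
    L = Lnew Q a₀ l' pw qw

    l'-all-embedded : ∀ {u v} (p q : Path (remove Q a₀) u v) → Cl Q L (embed p) (embed q)
    l'-all-embedded p q = embed-Cl old (l'-all p q)

  Cl-through-W : ∀ {w v} → W Q a₀ w → acc Q a₀ w v →
                 (p : Path (remove Q a₀) (src Q a₀) v) (q : Path (remove Q a₀) (tgt Q a₀) v) →
                 Cl Q L (embed p) (a₀ ∷ embed q)
  Cl-through-W {w} w∈W r p q = begin
    embed p                             ≈⟨ l'-all-embedded p (pw w w∈W ++ r) ⟩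
    embed (pw w w∈W ++ r)               ≡⟨ embed-++ (pw w w∈W) r ⟩
    embed (pw w w∈W) ++ embed r         ≈⟨ cong (gen (new w w∈W)) rfl ⟩
    a₀ ∷ (embed (qw w w∈W) ++ embed r)  ≡⟨ ≡.cong (a₀ ∷_) (embed-++ (qw w w∈W) r) ⟨
    a₀ ∷ embed (qw w w∈W ++ r)          ≈⟨ Cl-∷ a₀ (l'-all-embedded (qw w w∈W ++ r) q) ⟩
    a₀ ∷ embed q                        ∎
    where open SetoidReasoning (Cl-setoid Q L _ _)

  ClIsAll-Lnew : (∀ {u v} (p : Path Q u v) → Shape Q a₀ p) →
                 (∀ {v} → W̃ Q a₀ v → Σ V λ w → W Q a₀ w × acc Q a₀ w v) →
                 ClIsAll Q L
  ClIsAll-Lnew shape W-below p q = Cl-shapes (shape p) (shape q)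
    where
    Cl-mixed : ∀ {v} (p : Path (remove Q a₀) (src Q a₀) v) (q : Path (remove Q a₀) (tgt Q a₀) v) →
               Cl Q L (embed p) (a₀ ∷ embed q)
    Cl-mixed p q with W-below (p , q)
    ... | w , w∈W , r = Cl-through-W w∈W r p q

    Cl-shapes : ∀ {u v} {p q : Path Q u v} → Shape Q a₀ p → Shape Q a₀ q → Cl Q L p q
    Cl-shapes (avoiding p) (avoiding q) = l'-all-embedded p q
    Cl-shapes (avoiding p) (via-a₀ q)   = Cl-mixed p q
    Cl-shapes (via-a₀ p)   (avoiding q) = sym (Cl-mixed q p)
    Cl-shapes (via-a₀ p)   (via-a₀ q)   = Cl-∷ a₀ (l'-all-embedded p q)

module Ranked {V : Set} (Q : Quiver V) (rank : V → ℕ)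
              (ranked : ∀ a → rank (tgt Q a) < rank (src Q a)) where

  path-rank-≤ : ∀ {x y} → Path Q x y → rank y ≤ rank x
  path-rank-≤ []      = ≤-refl
  path-rank-≤ (a ∷ p) = ≤-trans (path-rank-≤ p) (<⇒≤ (ranked a))

  path-rank-< : ∀ {x y} → Path Q x y → x ≢ y → rank y < rank x
  path-rank-< []      x≢x = ⊥-elim (x≢x refl)
  path-rank-< (a ∷ p) _   = ≤-<-trans (path-rank-≤ p) (ranked a)

  module _ (a₀ : Arr Q) where

    unembed : ∀ {x y} (p : Path Q x y) → rank x < rank (src Q a₀) →
              Σ (Path (remove Q a₀) x y) λ p' → embed p' ≡ p
    unembed []      _    = [] , refl
    unembed (a ∷ p) x<u₀ with unembed p (<-trans (ranked a) x<u₀)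
    ... | p' , refl = (a , a≢a₀) ∷ p' , refl
      where
      a≢a₀ : a ≢ a₀
      a≢a₀ refl = <-irrefl refl x<u₀

    shape : DecidableEquality (Arr Q) → (∀ a → rank (src Q a) ≤ rank (src Q a₀)) →
            ∀ {u v} (p : Path Q u v) → Shape Q a₀ p
    shape _≟_ top []      = avoiding []
    shape _≟_ top (a ∷ p) with unembed p (<-≤-trans (ranked a) (top a))
    ... | p' , refl with a ≟ a₀
    ... | yes refl = via-a₀ p'
    ... | no a≢a₀  = avoiding ((a , a≢a₀) ∷ p')

module Finite {k m : ℕ} {s t : Fin m → Fin (suc k)}
              (t<s : ∀ a → toℕ (t a) < toℕ (s a)) (a₀ : Fin m) where

  private
    Q : Quiver (Fin (suc k))
    Q = finQuiver s t

  open Ranked (remove Q a₀) toℕ (t<s ∘ proj₁)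

  acc? : ∀ x y → Dec (acc Q a₀ x y)
  acc? x y = acc?′ x (<-wellFounded x)
    where
    acc?′ : ∀ x → Acc Fin._<_ x → Dec (acc Q a₀ x y)
    acc?′ x (WF.acc rs) with x ≟ᶠ y
    ... | yes refl = yes []
    ... | no x≢y   = map′ (λ { (a , refl , a≢a₀ , r) → (a , a≢a₀) ∷ r }) first-arrow (any? arrow-out?)
      where
      first-arrow : acc Q a₀ x y → Σ (Fin m) λ a → s a ≡ x × a ≢ a₀ × acc Q a₀ (t a) y
      first-arrow []      = ⊥-elim (x≢y refl)
      first-arrow (b ∷ r) = proj₁ b , refl , proj₂ b , r

      arrow-out? : ∀ a → Dec (s a ≡ x × a ≢ a₀ × acc Q a₀ (t a) y)
      arrow-out? a with s a ≟ᶠ x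
      ... | no s≢x   = no (s≢x ∘ proj₁)
      ... | yes refl = map′ (refl ,_) proj₂ (¬? (a ≟ᶠ a₀) ×-dec acc?′ (t a) (rs (t<s a)))

  W̃? : ∀ w → Dec (W̃ Q a₀ w)
  W̃? w = acc? (s a₀) w ×-dec acc? (t a₀) w

  W-below : ∀ {v} → W̃ Q a₀ v → Σ (Fin (suc k)) λ w → W Q a₀ w × acc Q a₀ w v
  W-below {v} v∈W̃ = climb v v∈W̃ [] (>-wellFounded v)
    where
    climb : ∀ w → W̃ Q a₀ w → acc Q a₀ w v → Acc Fin._>_ w →
            Σ (Fin (suc k)) λ w → W Q a₀ w × acc Q a₀ w v
    climb w w∈W̃ r (WF.acc rs)
      with any? (λ w' → W̃? w' ×-dec (¬? (w' ≟ᶠ w) ×-dec acc? w' w))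
    ... | yes (w' , w'∈W̃ , w'≢w , r') = climb w' w'∈W̃ (r' ++ r) (rs (path-rank-< r' w'≢w))
    ... | no ∄w' = w , (w∈W̃ , λ w' w'∈W̃ w'≢w r' → ∄w' (w' , w'∈W̃ , w'≢w , r')) , r

proposition1 : (k m : ℕ) (s t : Fin m → Fin (suc k)) →
    (∀ a → toℕ (t a) < toℕ (s a)) →
    (a₀ : Fin m) → s a₀ ≡ fromℕ k →
    (l' : BipathSet (remove (finQuiver s t) a₀)) →
    ClIsAll (remove (finQuiver s t) a₀) l' →
    (pw : ∀ w → W (finQuiver s t) a₀ w → Path (remove (finQuiver s t) a₀) (s a₀) w) →
    (qw : ∀ w → W (finQuiver s t) a₀ w → Path (remove (finQuiver s t) a₀) (t a₀) w) →
    ClIsAll (finQuiver s t) (Lnew (finQuiver s t) a₀ l' pw qw)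
proposition1 k m s t t<s a₀ s-a₀≡top l' l'-all pw qw =
  ClIsAll-Lnew l'-all pw qw
    (Ranked.shape (finQuiver s t) toℕ t<s a₀ _≟ᶠ_ below-top)
    (Finite.W-below t<s a₀)
  where
  below-top : ∀ a → toℕ (s a) ≤ toℕ (s a₀)
  below-top a rewrite s-a₀≡top | toℕ-fromℕ k = toℕ≤pred[n] (s a)
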